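{- Let $a,b>0$ be integers. Then $1-z^{\frac{a+b}{\gcd(a,b)}}$ lies in the ideal of $\mathbb{Q}[z,q,q^{ -1}]$ generated by $1-q^az$ and $1-z/q^b$. Furthermore, if $a>b$, then $1-z^{\frac{a-b}{\gcd(a,b)}}$ lies in the ideal generated by $1-q^az$ and $1-q^bz$, and also in the ideal generated by $1-z/q^a$ and $1-z/q^b$.
   Context: All ideals are ideals of the ring $\mathbb{Q}[z,q,q^{ -1}]$ of Laurent polynomials in $q$ with coefficients in $\mathbb{Q}[z]$. -}

module Defs where

open import Data.Nat as ℕ using (ℕ; zero; suc)
open import Data.Nat.DivMod using (_/_)
open import Data.Integer as ℤ using (ℤ; +_)
open import Data.Rational as ℚ using (ℚ; 0ℚ; 1ℚ)
open import Data.List using (List; []; _∷_; _++_; map; concatMap)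
open import Data.Product using (Σ; _×_; _,_)
open import Relation.Nullary using (yes; no)
open import Relation.Binary.PropositionalEquality using (_≡_)

-- Elements of the ring ℚ[z, q, q⁻¹] (polynomials in z, Laurent in q),
-- represented as finite formal sums of monomials  c · z^i · q^j
-- (c ∈ ℚ, i ∈ ℕ, j ∈ ℤ).  Two representations denote the same ring
-- element iff all their coefficients agree (see _≈_ below).

record Mono : Set where
  constructor mono
  field
    coef : ℚ
    zexp : ℕ
    qexp : ℤ

Laurent : Set
Laurent = List Mono

coeff : Laurent → ℕ → ℤ → ℚ
coeff [] i j = 0ℚ
coeff (mono c i' j' ∷ p) i j with i' ℕ.≟ i | j' ℤ.≟ j
... | yes _ | yes _ = c ℚ.+ coeff p i j
... | _     | _     = coeff p i j

_≈_ : Laurent → Laurent → Set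
p ≈ r = ∀ i j → coeff p i j ≡ coeff r i j

infix 4 _≈_
infixl 6 _+ᴸ_ _-ᴸ_
infixl 7 _*ᴸ_

_+ᴸ_ : Laurent → Laurent → Laurent
p +ᴸ r = p ++ r

negᴸ : Laurent → Laurent
negᴸ = map (λ { (mono c i j) → mono (ℚ.- c) i j })

_-ᴸ_ : Laurent → Laurent → Laurent
p -ᴸ r = p +ᴸ negᴸ r

mulMono : Mono → Mono → Mono
mulMono (mono c i j) (mono c' i' j') = mono (c ℚ.* c') (i ℕ.+ i') (j ℤ.+ j')

_*ᴸ_ : Laurent → Laurent → Laurent
p *ᴸ r = concatMap (λ m → map (mulMono m) r) p

oneᴸ : Laurent
oneᴸ = mono 1ℚ 0 (+ 0) ∷ []

-- the monomial z^i q^j (coefficient 1); e.g. q^a z = zq 1 (+ a), z/q^b = zq 1 (- + b)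
zq : ℕ → ℤ → Laurent
zq i j = mono 1ℚ i j ∷ []

InIdeal₂ : Laurent → Laurent → Laurent → Set
InIdeal₂ g₁ g₂ f = Σ Laurent λ u → Σ Laurent λ v → f ≈ u *ᴸ g₁ +ᴸ v *ᴸ g₂

-- natural-number division (total; only ever used with a nonzero divisor,
-- namely gcd a b with a > 0)
_div_ : ℕ → ℕ → ℕ
m div zero = zero
m div suc k = m / suc k

{-# OPTIONS --safe #-}
module Submission where

-- Put X = q^a z and Y = z/q^b, and write a = a′g, b = b′g with g = gcd a b.
-- Then X^b′ Y^a′ = z^(a′+b′), and 1 − X^m Y^n = (1 − X^m) + X^m (1 − Y^n) lies in
-- the ideal (1 − X, 1 − Y) because 1 − X^m is 1 − X times a geometric sum.
-- For a > b and Y = q^b z (or X = z/q^a, Y = z/q^b) one has instead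
-- z^(a′−b′) X^b′ = Y^a′, and 1 − M = (1 − Y^n) − M (1 − X^m) whenever M X^m = Y^n.

open import Defs
open import Data.Nat using (ℕ; _+_; _∸_; _<_; _>_)
open import Data.Nat.GCD using (gcd)
open import Data.Integer using (+_; -_)
open import Data.Product using (_×_)

open import Data.Integer as ℤ using (ℤ; 0ℤ)
import Data.Integer.Properties as ℤ
open import Data.List using ([]; _∷_; map)
open import Data.Nat using (suc; _*_)
open import Data.Nat.DivMod using (m*n/n≡m)
open import Data.Nat.Divisibility using (_∣_; quotient; m∣n⇒n≡quotient*m)
open import Data.Nat.GCD using (gcd[m,n]∣m; gcd[m,n]∣n; gcd[m,n]≢0)
import Data.Nat.Properties as ℕ
open import Algebra.Properties.CommutativeSemigroup ℕ.*-commutativeSemigroup using (x∙yz≈y∙xz)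
open import Data.Product using (_,_)
open import Data.Rational as ℚ using (ℚ; 1ℚ)
import Data.Rational.Properties as ℚ
open import Data.Rational.Solver using (module +-*-Solver)
open import Data.Sum using (inj₁)
open import Relation.Binary.Bundles using (Setoid)
open import Relation.Binary.PropositionalEquality
open import Relation.Nullary using (yes; no)

open +-*-Solver using (solve; _:+_; _:-_; :-_; _:=_)

coeff-+ᴸ : ∀ p r i j → coeff (p +ᴸ r) i j ≡ coeff p i j ℚ.+ coeff r i j
coeff-+ᴸ []                 r i j = sym (ℚ.+-identityˡ (coeff r i j))
coeff-+ᴸ (mono c i′ j′ ∷ p) r i j with i′ ℕ.≟ i | j′ ℤ.≟ j
... | yes _ | yes _ = trans (cong (c ℚ.+_) (coeff-+ᴸ p r i j)) (sym (ℚ.+-assoc c _ _))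
... | yes _ | no _  = coeff-+ᴸ p r i j
... | no _  | _     = coeff-+ᴸ p r i j

coeff-negᴸ : ∀ p i j → coeff (negᴸ p) i j ≡ ℚ.- coeff p i j
coeff-negᴸ []                 i j = refl
coeff-negᴸ (mono c i′ j′ ∷ p) i j with i′ ℕ.≟ i | j′ ℤ.≟ j
... | yes _ | yes _ = trans (cong (ℚ.- c ℚ.+_) (coeff-negᴸ p i j)) (sym (ℚ.neg-distrib-+ c _))
... | yes _ | no _  = coeff-negᴸ p i j
... | no _  | _     = coeff-negᴸ p i j

coeff-subᴸ : ∀ p r i j → coeff (p -ᴸ r) i j ≡ coeff p i j ℚ.- coeff r i j
coeff-subᴸ p r i j = trans (coeff-+ᴸ p (negᴸ r) i j) (cong (coeff p i j ℚ.+_) (coeff-negᴸ r i j))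

-- Unlike _≈_, which unfolds to a function type, this record type is injective
-- in its indices, so Agda can infer the polynomials of an equation from it.
record _≋_ (p r : Laurent) : Set where
  constructor coeffwise
  field ≋⇒≈ : p ≈ r

open _≋_

infix 4 _≋_

≋-setoid : Setoid _ _
≋-setoid = record
  { Carrier       = Laurent
  ; _≈_           = _≋_
  ; isEquivalence = record
    { refl  = coeffwise λ _ _ → refl
    ; sym   = λ (coeffwise p≈r) → coeffwise λ i j → sym (p≈r i j)
    ; trans = λ (coeffwise p≈r) (coeffwise r≈s) → coeffwise λ i j → trans (p≈r i j) (r≈s i j)
    }
  }

open Setoid ≋-setoid using () renaming (refl to ≋-refl; sym to ≋-sym; reflexive to ≋-reflexive)
import Relation.Binary.Reasoning.Setoid ≋-setoid as ≋-Reasoning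

+ᴸ-cong : ∀ {p p′ r r′} → p ≋ p′ → r ≋ r′ → p +ᴸ r ≋ p′ +ᴸ r′
+ᴸ-cong {p} {p′} {r} {r′} (coeffwise p≈p′) (coeffwise r≈r′) = coeffwise λ i j → begin
  coeff (p +ᴸ r) i j             ≡⟨ coeff-+ᴸ p r i j ⟩
  coeff p i j ℚ.+ coeff r i j    ≡⟨ cong₂ ℚ._+_ (p≈p′ i j) (r≈r′ i j) ⟩
  coeff p′ i j ℚ.+ coeff r′ i j  ≡⟨ coeff-+ᴸ p′ r′ i j ⟨
  coeff (p′ +ᴸ r′) i j           ∎
  where open ≡-Reasoning

+ᴸ-comm : ∀ p r → p +ᴸ r ≋ r +ᴸ p
+ᴸ-comm p r = coeffwise λ i j → begin
  coeff (p +ᴸ r) i j           ≡⟨ coeff-+ᴸ p r i j ⟩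
  coeff p i j ℚ.+ coeff r i j  ≡⟨ ℚ.+-comm (coeff p i j) (coeff r i j) ⟩
  coeff r i j ℚ.+ coeff p i j  ≡⟨ coeff-+ᴸ r p i j ⟨
  coeff (r +ᴸ p) i j           ∎
  where open ≡-Reasoning

-ᴸ-inverseʳ : ∀ p → p -ᴸ p ≋ []
-ᴸ-inverseʳ p = coeffwise λ i j → trans (coeff-subᴸ p p i j) (ℚ.+-inverseʳ (coeff p i j))

negᴸ-subᴸ-negᴸ : ∀ p r → negᴸ p -ᴸ negᴸ r ≋ r -ᴸ p
negᴸ-subᴸ-negᴸ p r = coeffwise λ i j → begin
  coeff (negᴸ p -ᴸ negᴸ r) i j
    ≡⟨ coeff-subᴸ (negᴸ p) (negᴸ r) i j ⟩
  coeff (negᴸ p) i j ℚ.- coeff (negᴸ r) i j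
    ≡⟨ cong₂ ℚ._-_ (coeff-negᴸ p i j) (coeff-negᴸ r i j) ⟩
  ℚ.- coeff p i j ℚ.- ℚ.- coeff r i j
    ≡⟨ solve 2 (λ P R → :- P :- :- R := R :- P) refl (coeff p i j) (coeff r i j) ⟩
  coeff r i j ℚ.- coeff p i j
    ≡⟨ coeff-subᴸ r p i j ⟨
  coeff (r -ᴸ p) i j
    ∎
  where open ≡-Reasoning

-ᴸ-telescope : ∀ p r s → p -ᴸ r +ᴸ (r -ᴸ s) ≋ p -ᴸ s
-ᴸ-telescope p r s = coeffwise λ i j → begin
  coeff (p -ᴸ r +ᴸ (r -ᴸ s)) i j
    ≡⟨ coeff-+ᴸ (p -ᴸ r) (r -ᴸ s) i j ⟩
  coeff (p -ᴸ r) i j ℚ.+ coeff (r -ᴸ s) i j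
    ≡⟨ cong₂ ℚ._+_ (coeff-subᴸ p r i j) (coeff-subᴸ r s i j) ⟩
  coeff p i j ℚ.- coeff r i j ℚ.+ (coeff r i j ℚ.- coeff s i j)
    ≡⟨ solve 3 (λ P R S → P :- R :+ (R :- S) := P :- S) refl (coeff p i j) (coeff r i j) (coeff s i j) ⟩
  coeff p i j ℚ.- coeff s i j
    ≡⟨ coeff-subᴸ p s i j ⟨
  coeff (p -ᴸ s) i j
    ∎
  where open ≡-Reasoning

monomial : ℚ → ℕ → ℤ → Laurent
monomial c i j = mono c i j ∷ []

mulMono-binomial : ∀ c i j s t →
  map (mulMono (mono c i j)) (oneᴸ -ᴸ zq s t) ≡ monomial c i j -ᴸ monomial c (i + s) (j ℤ.+ t)
mulMono-binomial c i j s t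
  rewrite ℚ.*-identityʳ c | ℕ.+-identityʳ i | ℤ.+-identityʳ j
        | sym (ℚ.neg-distribʳ-* c 1ℚ) | ℚ.*-identityʳ c = refl

geometricSum : ℚ → ℕ → ℤ → ℕ → ℤ → ℕ → Laurent
geometricSum c i j s t 0       = []
geometricSum c i j s t (suc n) = mono c i j ∷ geometricSum c (i + s) (j ℤ.+ t) s t n

geometricSum-telescopes : ∀ c i j s t n {i′ j′} → i′ ≡ i + n * s → j′ ≡ j ℤ.+ + n ℤ.* t →
  geometricSum c i j s t n *ᴸ (oneᴸ -ᴸ zq s t) ≋ monomial c i j -ᴸ monomial c i′ j′
geometricSum-telescopes c i j s t 0 i′≡ j′≡
  rewrite trans i′≡ (ℕ.+-identityʳ i) | trans j′≡ (ℤ.+-identityʳ j) = ≋-sym (-ᴸ-inverseʳ (monomial c i j))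
geometricSum-telescopes c i j s t (suc n) {i′} {j′} i′≡ j′≡ = begin
  map (mulMono (mono c i j)) 1-X +ᴸ geometricSum c (i + s) (j ℤ.+ t) s t n *ᴸ 1-X
    ≈⟨ +ᴸ-cong (≋-reflexive (mulMono-binomial c i j s t))
               (geometricSum-telescopes c (i + s) (j ℤ.+ t) s t n i′≡′ j′≡′) ⟩
  cX⁰ -ᴸ cX¹ +ᴸ (cX¹ -ᴸ monomial c i′ j′)
    ≈⟨ -ᴸ-telescope cX⁰ cX¹ (monomial c i′ j′) ⟩
  cX⁰ -ᴸ monomial c i′ j′
    ∎
  where
  open ≋-Reasoning
  1-X cX⁰ cX¹ : Laurent
  1-X = oneᴸ -ᴸ zq s t
  cX⁰ = monomial c i j
  cX¹ = monomial c (i + s) (j ℤ.+ t)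
  i′≡′ : i′ ≡ i + s + n * s
  i′≡′ = trans i′≡ (sym (ℕ.+-assoc i s (n * s)))
  j′≡′ : j′ ≡ j ℤ.+ t ℤ.+ + n ℤ.* t
  j′≡′ = trans j′≡ (trans (cong (ℤ._+_ j) (ℤ.suc-* (+ n) t)) (sym (ℤ.+-assoc j t (+ n ℤ.* t))))

1-XᵐYⁿ∈⟨1-X,1-Y⟩ : ∀ {s₁ t₁ s₂ t₂ i j} m n → i ≡ m * s₁ + n * s₂ → j ≡ + m ℤ.* t₁ ℤ.+ + n ℤ.* t₂ →
  InIdeal₂ (oneᴸ -ᴸ zq s₁ t₁) (oneᴸ -ᴸ zq s₂ t₂) (oneᴸ -ᴸ zq i j)
1-XᵐYⁿ∈⟨1-X,1-Y⟩ {s₁} {t₁} {s₂} {t₂} {i} {j} m n i≡ j≡ = Xᵐ-sum , Yⁿ-sum , ≋⇒≈ (≋-sym (begin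
  Xᵐ-sum *ᴸ (oneᴸ -ᴸ zq s₁ t₁) +ᴸ Yⁿ-sum *ᴸ (oneᴸ -ᴸ zq s₂ t₂)
    ≈⟨ +ᴸ-cong (geometricSum-telescopes 1ℚ 0 0ℤ s₁ t₁ m refl (sym (ℤ.+-identityˡ _)))
               (geometricSum-telescopes 1ℚ (m * s₁) (+ m ℤ.* t₁) s₂ t₂ n i≡ j≡) ⟩
  oneᴸ -ᴸ Xᵐ +ᴸ (Xᵐ -ᴸ zq i j)
    ≈⟨ -ᴸ-telescope oneᴸ Xᵐ (zq i j) ⟩
  oneᴸ -ᴸ zq i j
    ∎))
  where
  open ≋-Reasoning
  Xᵐ Xᵐ-sum Yⁿ-sum : Laurent
  Xᵐ = zq (m * s₁) (+ m ℤ.* t₁)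
  Xᵐ-sum = geometricSum 1ℚ 0 0ℤ s₁ t₁ m
  Yⁿ-sum = geometricSum 1ℚ (m * s₁) (+ m ℤ.* t₁) s₂ t₂ n

1-Yⁿ/Xᵐ∈⟨1-X,1-Y⟩ : ∀ {s₁ t₁ s₂ t₂ i j} m n → i + m * s₁ ≡ n * s₂ → j ℤ.+ + m ℤ.* t₁ ≡ + n ℤ.* t₂ →
  InIdeal₂ (oneᴸ -ᴸ zq s₁ t₁) (oneᴸ -ᴸ zq s₂ t₂) (oneᴸ -ᴸ zq i j)
1-Yⁿ/Xᵐ∈⟨1-X,1-Y⟩ {s₁} {t₁} {s₂} {t₂} {i} {j} m n i≡ j≡ = Xᵐ-sum , Yⁿ-sum , ≋⇒≈ (≋-sym (begin
  Xᵐ-sum *ᴸ (oneᴸ -ᴸ zq s₁ t₁) +ᴸ Yⁿ-sum *ᴸ (oneᴸ -ᴸ zq s₂ t₂)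
    ≈⟨ +ᴸ-cong (geometricSum-telescopes (ℚ.- 1ℚ) i j s₁ t₁ m (sym i≡) (sym j≡))
               (geometricSum-telescopes 1ℚ 0 0ℤ s₂ t₂ n refl (sym (ℤ.+-identityˡ _))) ⟩
  negᴸ (zq i j) -ᴸ negᴸ Yⁿ +ᴸ (oneᴸ -ᴸ Yⁿ)
    ≈⟨ +ᴸ-cong (negᴸ-subᴸ-negᴸ (zq i j) Yⁿ) ≋-refl ⟩
  Yⁿ -ᴸ zq i j +ᴸ (oneᴸ -ᴸ Yⁿ)
    ≈⟨ +ᴸ-comm (Yⁿ -ᴸ zq i j) (oneᴸ -ᴸ Yⁿ) ⟩
  oneᴸ -ᴸ Yⁿ +ᴸ (Yⁿ -ᴸ zq i j)
    ≈⟨ -ᴸ-telescope oneᴸ Yⁿ (zq i j) ⟩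
  oneᴸ -ᴸ zq i j
    ∎))
  where
  open ≋-Reasoning
  Yⁿ Xᵐ-sum Yⁿ-sum : Laurent
  Yⁿ = zq (n * s₂) (+ n ℤ.* t₂)
  Xᵐ-sum = geometricSum (ℚ.- 1ℚ) i j s₁ t₁ m
  Yⁿ-sum = geometricSum 1ℚ 0 0ℤ s₂ t₂ n

m*n-div-n≡m : ∀ m {n} → 0 < n → (m * n) div n ≡ m
m*n-div-n≡m m {suc n} _ = m*n/n≡m m (suc n)

module _ {a b g : ℕ} (g∣a : g ∣ a) (g∣b : g ∣ b) where
  open ≡-Reasoning

  private
    a′ b′ : ℕ
    a′ = quotient g∣a
    b′ = quotient g∣b
    a≡a′g : a ≡ a′ * g
    a≡a′g = m∣n⇒n≡quotient*m g∣a
    b≡b′g : b ≡ b′ * g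
    b≡b′g = m∣n⇒n≡quotient*m g∣b

  b′a≡a′b : b′ * a ≡ a′ * b
  b′a≡a′b = begin
    b′ * a        ≡⟨ cong (b′ *_) a≡a′g ⟩
    b′ * (a′ * g) ≡⟨ x∙yz≈y∙xz b′ a′ g ⟩
    a′ * (b′ * g) ≡⟨ cong (a′ *_) b≡b′g ⟨
    a′ * b        ∎

  +b′*+a≡+a′*+b : + b′ ℤ.* + a ≡ + a′ ℤ.* + b
  +b′*+a≡+a′*+b = begin
    + b′ ℤ.* + a  ≡⟨ ℤ.pos-* b′ a ⟨
    + (b′ * a)    ≡⟨ cong +_ b′a≡a′b ⟩
    + (a′ * b)    ≡⟨ ℤ.pos-* a′ b ⟩
    + a′ ℤ.* + b  ∎

  +b′*-a≡+a′*-b : + b′ ℤ.* - + a ≡ + a′ ℤ.* - + b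
  +b′*-a≡+a′*-b = begin
    + b′ ℤ.* - + a    ≡⟨ ℤ.neg-distribʳ-* (+ b′) (+ a) ⟨
    - (+ b′ ℤ.* + a)  ≡⟨ cong -_ +b′*+a≡+a′*+b ⟩
    - (+ a′ ℤ.* + b)  ≡⟨ ℤ.neg-distribʳ-* (+ a′) (+ b) ⟩
    + a′ ℤ.* - + b    ∎

  [a+b]div-g≡a′+b′ : 0 < g → (a + b) div g ≡ a′ + b′
  [a+b]div-g≡a′+b′ 0<g = begin
    (a + b) div g           ≡⟨ cong₂ (λ x y → (x + y) div g) a≡a′g b≡b′g ⟩
    (a′ * g + b′ * g) div g ≡⟨ cong (_div g) (ℕ.*-distribʳ-+ g a′ b′) ⟨
    ((a′ + b′) * g) div g   ≡⟨ m*n-div-n≡m (a′ + b′) 0<g ⟩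
    a′ + b′                 ∎

  [a∸b]div-g+b′≡a′ : 0 < g → b < a → (a ∸ b) div g + b′ ≡ a′
  [a∸b]div-g+b′≡a′ 0<g b<a = begin
    (a ∸ b) div g + b′           ≡⟨ cong₂ (λ x y → (x ∸ y) div g + b′) a≡a′g b≡b′g ⟩
    (a′ * g ∸ b′ * g) div g + b′ ≡⟨ cong (λ x → x div g + b′) (ℕ.*-distribʳ-∸ g a′ b′) ⟨
    ((a′ ∸ b′) * g) div g + b′   ≡⟨ cong (_+ b′) (m*n-div-n≡m (a′ ∸ b′) 0<g) ⟩
    a′ ∸ b′ + b′                 ≡⟨ ℕ.m∸n+n≡m (ℕ.<⇒≤ b′<a′) ⟩
    a′                           ∎
    where
    b′<a′ : b′ < a′
    b′<a′ = ℕ.*-cancelʳ-< g b′ a′ (subst₂ _<_ b≡b′g a≡a′g b<a)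

proposition4p2 : (a b : ℕ) → 0 < a → 0 < b →
      InIdeal₂ (oneᴸ -ᴸ zq 1 (+ a)) (oneᴸ -ᴸ zq 1 (- (+ b)))
               (oneᴸ -ᴸ zq ((a + b) div gcd a b) (+ 0))
    × (a > b →
        InIdeal₂ (oneᴸ -ᴸ zq 1 (+ a)) (oneᴸ -ᴸ zq 1 (+ b))
                 (oneᴸ -ᴸ zq ((a ∸ b) div gcd a b) (+ 0))
      × InIdeal₂ (oneᴸ -ᴸ zq 1 (- (+ a))) (oneᴸ -ᴸ zq 1 (- (+ b)))
                 (oneᴸ -ᴸ zq ((a ∸ b) div gcd a b) (+ 0)))
proposition4p2 a b 0<a _ =
    1-XᵐYⁿ∈⟨1-X,1-Y⟩ b′ a′ z-sum q-sum
  , λ a>b → 1-Yⁿ/Xᵐ∈⟨1-X,1-Y⟩ b′ a′ (z-diff a>b) (trans (ℤ.+-identityˡ _) (+b′*+a≡+a′*+b g∣a g∣b))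
          , 1-Yⁿ/Xᵐ∈⟨1-X,1-Y⟩ b′ a′ (z-diff a>b) (trans (ℤ.+-identityˡ _) (+b′*-a≡+a′*-b g∣a g∣b))
  where
  g∣a = gcd[m,n]∣m a b
  g∣b = gcd[m,n]∣n a b
  a′ b′ : ℕ
  a′ = quotient g∣a
  b′ = quotient g∣b
  0<g : 0 < gcd a b
  0<g = ℕ.n≢0⇒n>0 (gcd[m,n]≢0 a b (inj₁ (ℕ.m<n⇒n≢0 0<a)))
  z-sum : (a + b) div gcd a b ≡ b′ * 1 + a′ * 1
  z-sum = trans ([a+b]div-g≡a′+b′ g∣a g∣b 0<g)
                (trans (ℕ.+-comm a′ b′) (sym (cong₂ _+_ (ℕ.*-identityʳ b′) (ℕ.*-identityʳ a′))))
  z-diff : a > b → (a ∸ b) div gcd a b + b′ * 1 ≡ a′ * 1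
  z-diff a>b = trans (cong (_+_ ((a ∸ b) div gcd a b)) (ℕ.*-identityʳ b′))
                     (trans ([a∸b]div-g+b′≡a′ g∣a g∣b 0<g a>b) (sym (ℕ.*-identityʳ a′)))
  q-sum : 0ℤ ≡ + b′ ℤ.* + a ℤ.+ + a′ ℤ.* - + b
  q-sum = trans (sym (ℤ.+-inverseʳ (+ a′ ℤ.* + b)))
                (cong₂ ℤ._+_ (sym (+b′*+a≡+a′*+b g∣a g∣b)) (ℤ.neg-distribʳ-* (+ a′) (+ b)))
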